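{- Let $n\ge 2$ and $N\ge 4n+4$. Then the complete graph $K_N$ on $N$ vertices has the following property: given any matching $M$ in $K_N$, any edges $e_1,\dots,e_k$ of $K_N-M$ with $k\le n$, and any two vertices $v,w$ of $K_N$, there is a non-edge-repeating trail from $v$ to $w$ in $K_N-M$ containing the edges $e_1,\dots,e_k$.
   Context: A matching in a graph is a set of pairwise non-adjacent edges; $K_N-M$ is the graph obtained from $K_N$ by deleting the edges of $M$. -}

module Defs where

open import Data.Nat using (ℕ)
open import Data.Fin using (Fin)
open import Data.Product using (_×_; _,_; Σ; ∃-syntax)
open import Data.Sum using (_⊎_)
open import Data.List using (List; []; _∷_)
open import Data.List.Relation.Unary.All using (All)
open import Data.List.Relation.Unary.Any using (Any)
open import Data.List.Relation.Unary.AllPairs using (AllPairs)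
open import Relation.Binary.PropositionalEquality using (_≡_; _≢_)
open import Relation.Nullary using (¬_)

-- Vertices of K_N are Fin N.  An edge is represented by an ordered pair of
-- endpoints; two pairs denote the same (undirected) edge iff they agree up to swap.
Pair : ℕ → Set
Pair N = Fin N × Fin N

SameEdge : ∀ {N} → Pair N → Pair N → Set
SameEdge (a , b) (c , d) = (a ≡ c × b ≡ d) ⊎ (a ≡ d × b ≡ c)

IsEdgeKN : ∀ {N} → Pair N → Set
IsEdgeKN (a , b) = a ≢ b

NonAdjacent : ∀ {N} → Pair N → Pair N → Set
NonAdjacent (a , b) (c , d) = a ≢ c × a ≢ d × b ≢ c × b ≢ d

IsMatching : ∀ {N} → List (Pair N) → Set
IsMatching M = All IsEdgeKN M × AllPairs NonAdjacent M

IsEdgeMinus : ∀ {N} → List (Pair N) → Pair N → Set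
IsEdgeMinus M e = IsEdgeKN e × ¬ Any (SameEdge e) M

-- A walk starting at x, given by the list of subsequent vertices.
walkEdges : ∀ {N} → Fin N → List (Fin N) → List (Pair N)
walkEdges x [] = []
walkEdges x (y ∷ ys) = (x , y) ∷ walkEdges y ys

walkEnd : ∀ {N} → Fin N → List (Fin N) → Fin N
walkEnd x [] = x
walkEnd x (y ∷ ys) = walkEnd y ys

IsTrail : ∀ {N} → List (Pair N) → Fin N → Fin N → List (Fin N) → Set
IsTrail M v w xs =
  walkEnd v xs ≡ w
  × All (IsEdgeMinus M) (walkEdges v xs)
  × AllPairs (λ e f → ¬ SameEdge e f) (walkEdges v xs)

TrailContains : ∀ {N} → Fin N → List (Fin N) → Pair N → Set
TrailContains v xs e = Any (SameEdge e) (walkEdges v xs)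

module Submission where

-- Let S be the set consisting of v, w and the endpoints of the
-- prescribed edges; |S| ≤ 2n + 2.  After removing repetitions the prescribed
-- edges d₁, …, d_k (k ≤ n) are pairwise distinct edges with both ends in S.
-- Starting at v we traverse d₁, …, d_k in this order (each from its first to
-- its second endpoint) and finally go to w.  Whenever the current vertex c is
-- not the first endpoint a of the next edge, we take a detour c – z – a
-- through a fresh vertex z that lies outside S, has not been used by an
-- earlier detour and is not matched by M to c or a; such z exists because at
-- most |S| + n + 2 ≤ 3n + 4 < N vertices are excluded.  The final step to w is
-- such a detour as well.  Edges are distinct because, at every stage, each
-- edge of the remaining trail is a remaining prescribed edge or has an
-- endpoint outside S and the detour vertices used so far (the Shape invariant),
-- whereas every edge just added lies inside this set.

open import Defs
open import Data.Nat using (ℕ; _≤_; _<_; _+_; _*_; suc; z≤n; s≤s)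
open import Data.Nat.Properties using (+-monoˡ-≤; ≤-trans; ≤-reflexive; +-mono-≤; +-monoʳ-≤; +-identityʳ; +-suc; m≤n+m; m≤m+n)
open import Data.Nat.Tactic.RingSolver using (solve-∀)
open import Data.Fin using (Fin; _≟_)
open import Data.Fin.Properties using (pigeonhole; ¬∀⟶∃¬; <⇒≢)
open import Data.Product using (_×_; ∃-syntax; _,_; proj₁; proj₂)
open import Data.Sum using (_⊎_; inj₁; inj₂; [_,_])
import Data.Sum as Sum
open import Data.List using (List; []; _∷_; _++_; length; map; lookup; deduplicate)
open import Data.List.Properties using (length-++; length-map; length-deduplicate)
open import Data.List.Relation.Unary.All using (All; []; _∷_)
import Data.List.Relation.Unary.All as All
import Data.List.Relation.Unary.All.Properties as All
open import Data.List.Relation.Unary.All.Properties.Core using (All¬⇒¬Any)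
open import Data.List.Relation.Unary.Any using (Any; here; there)
import Data.List.Relation.Unary.Any as Any
open import Data.List.Relation.Unary.Any.Properties using (lookup-index)
open import Data.List.Relation.Unary.AllPairs using (AllPairs; []; _∷_)
import Data.List.Relation.Unary.AllPairs.Properties as AllPairs
open import Data.List.Relation.Unary.Unique.DecSetoid.Properties using (deduplicate-!)
open import Data.List.Membership.Propositional using (_∈_; _∉_)
open import Data.List.Membership.Propositional.Properties using (∈-++⁺ˡ; ∈-++⁺ʳ; ∈-map⁺)
open import Relation.Binary.Bundles using (DecSetoid)
open import Relation.Binary.PropositionalEquality using (_≡_; _≢_; refl; sym; trans; cong; cong₂; subst; module ≡-Reasoning)
open import Relation.Nullary using (¬_; Dec; yes; no)
open import Relation.Nullary.Decidable using (_×-dec_; _⊎-dec_)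
open import Data.Empty using (⊥-elim)
open import Level using (0ℓ)
open import Function using (_∘_)

Distinct : ∀ {N} → Pair N → Pair N → Set
Distinct e f = ¬ SameEdge e f

SameEdge-refl : ∀ {N} {e : Pair N} → SameEdge e e
SameEdge-refl = inj₁ (refl , refl)

SameEdge-sym : ∀ {N} {e f : Pair N} → SameEdge e f → SameEdge f e
SameEdge-sym (inj₁ (refl , refl)) = inj₁ (refl , refl)
SameEdge-sym (inj₂ (refl , refl)) = inj₂ (refl , refl)

SameEdge-trans : ∀ {N} {e f g : Pair N} → SameEdge e f → SameEdge f g → SameEdge e g
SameEdge-trans (inj₁ (refl , refl)) q = q
SameEdge-trans (inj₂ (refl , refl)) (inj₁ (refl , refl)) = inj₂ (refl , refl)
SameEdge-trans (inj₂ (refl , refl)) (inj₂ (refl , refl)) = inj₁ (refl , refl)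

sameEdge? : ∀ {N} (e f : Pair N) → Dec (SameEdge e f)
sameEdge? (a , b) (c , d) = ((a ≟ c) ×-dec (b ≟ d)) ⊎-dec ((a ≟ d) ×-dec (b ≟ c))

-- The undirected edges of K_N as a decidable setoid; it lets us reuse the
-- library's deduplication and its uniqueness lemma.
edgeSetoid : ℕ → DecSetoid 0ℓ 0ℓ
edgeSetoid N = record
  { Carrier = Pair N
  ; _≈_ = SameEdge
  ; isDecEquivalence = record
    { isEquivalence = record { refl = SameEdge-refl ; sym = SameEdge-sym ; trans = SameEdge-trans }
    ; _≟_ = sameEdge?
    }
  }

IsEdgeMinus-swap : ∀ {N} {M : List (Pair N)} {a b : Fin N} → IsEdgeMinus M (a , b) → IsEdgeMinus M (b , a)
IsEdgeMinus-swap (a≢b , a-b∉M) = (λ b≡a → a≢b (sym b≡a)) , λ p → a-b∉M (Any.map (SameEdge-trans (inj₂ (refl , refl))) p)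

Within : ∀ {N} → (Fin N → Set) → Pair N → Set
Within X e = X (proj₁ e) × X (proj₂ e)

Within-resp : ∀ {N} {X : Fin N → Set} {e f : Pair N} → SameEdge e f → Within X e → Within X f
Within-resp (inj₁ (refl , refl)) w = w
Within-resp (inj₂ (refl , refl)) (x , y) = y , x

apart : ∀ {N} {X : Fin N → Set} {e f : Pair N} → Within X e → ¬ Within X f → Distinct e f
apart inside outside same = outside (Within-resp same inside)

detour-distinct : ∀ {N} {c z a : Fin N} → c ≢ z → c ≢ a → Distinct (c , z) (z , a)
detour-distinct c≢z _ (inj₁ (c≡z , _)) = c≢z c≡z
detour-distinct _ c≢a (inj₂ (c≡a , _)) = c≢a c≡a

otherEnd : ∀ {N} → Fin N → Pair N → List (Fin N)
otherEnd c (x , y) with c ≟ x | c ≟ y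
... | yes _ | _ = y ∷ []
... | no _ | yes _ = x ∷ []
... | no _ | no _ = []

partners : ∀ {N} → Fin N → List (Pair N) → List (Fin N)
partners c [] = []
partners c (e ∷ M) = otherEnd c e ++ partners c M

otherEnd-complete : ∀ {N} {c z : Fin N} (e : Pair N) → SameEdge (c , z) e → z ∈ otherEnd c e
otherEnd-complete {c = c} (x , y) same with c ≟ x | c ≟ y | same
... | yes _ | _ | inj₁ (_ , z≡y) = here z≡y
... | yes c≡x | _ | inj₂ (c≡y , z≡x) = here (trans z≡x (trans (sym c≡x) c≡y))
... | no c≢x | _ | inj₁ (c≡x , _) = ⊥-elim (c≢x c≡x)
... | no _ | yes _ | inj₂ (_ , z≡x) = here z≡x
... | no _ | no c≢y | inj₂ (c≡y , _) = ⊥-elim (c≢y c≡y)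

partners-complete : ∀ {N} {c z : Fin N} (M : List (Pair N)) → Any (SameEdge (c , z)) M → z ∈ partners c M
partners-complete (e ∷ M) (here same) = ∈-++⁺ˡ (otherEnd-complete e same)
partners-complete (e ∷ M) (there p) = ∈-++⁺ʳ (otherEnd _ e) (partners-complete M p)

partners-away : ∀ {N} (c : Fin N) (M : List (Pair N)) → All (λ e → c ≢ proj₁ e × c ≢ proj₂ e) M → partners c M ≡ []
partners-away c [] [] = refl
partners-away c ((x , y) ∷ M) ((c≢x , c≢y) ∷ away) with c ≟ x | c ≟ y
... | yes c≡x | _ = ⊥-elim (c≢x c≡x)
... | no _ | yes c≡y = ⊥-elim (c≢y c≡y)
... | no _ | no _ = partners-away c M away

partners-length : ∀ {N} (c : Fin N) (M : List (Pair N)) → AllPairs NonAdjacent M → length (partners c M) ≤ 1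
partners-length c [] [] = z≤n
partners-length c ((x , y) ∷ M) (apart ∷ matching) with c ≟ x | c ≟ y
... | yes refl | _ = s≤s (≤-reflexive (cong length (partners-away c M (All.map (λ (p , q , _) → p , q) apart))))
... | no _ | yes refl = s≤s (≤-reflexive (cong length (partners-away c M (All.map (λ (_ , _ , p , q) → p , q) apart))))
... | no _ | no _ = partners-length c M matching

edge-off-M : ∀ {N} {c z : Fin N} (M : List (Pair N)) → c ≢ z → z ∉ partners c M → IsEdgeMinus M (c , z)
edge-off-M M c≢z z∉ = c≢z , λ p → z∉ (partners-complete M p)

missing-vertex : ∀ {N} (L : List (Fin N)) → length L < N → ∃[ z ] z ∉ L
missing-vertex {N} L short = ¬∀⟶∃¬ N (_∈ L) (_∈? L) not-all
  where
  open import Data.List.Membership.DecPropositional (_≟_ {N}) using (_∈?_)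
  not-all : ¬ (∀ z → z ∈ L)
  not-all all with pigeonhole short (λ z → Any.index (all z))
  ... | i , j , i<j , same-position = <⇒≢ i<j (begin
    i                             ≡⟨ lookup-index (all i) ⟩
    lookup L (Any.index (all i))  ≡⟨ cong (lookup L) same-position ⟩
    lookup L (Any.index (all j))  ≡⟨ sym (lookup-index (all j)) ⟩
    j                             ∎)
    where open ≡-Reasoning

walkEdges-++ : ∀ {N} (c : Fin N) ys xs → walkEdges c (ys ++ xs) ≡ walkEdges c ys ++ walkEdges (walkEnd c ys) xs
walkEdges-++ c [] xs = refl
walkEdges-++ c (y ∷ ys) xs = cong ((c , y) ∷_) (walkEdges-++ y ys xs)

walkEnd-++ : ∀ {N} (c : Fin N) ys xs → walkEnd c (ys ++ xs) ≡ walkEnd (walkEnd c ys) xs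
walkEnd-++ c [] xs = refl
walkEnd-++ c (y ∷ ys) xs = walkEnd-++ y ys xs

prepend : ∀ {N} {M : List (Pair N)} {c w : Fin N} ys xs →
  IsTrail M (walkEnd c ys) w xs →
  All (IsEdgeMinus M) (walkEdges c ys) → AllPairs Distinct (walkEdges c ys) →
  All (λ e → All (Distinct e) (walkEdges (walkEnd c ys) xs)) (walkEdges c ys) →
  IsTrail M c w (ys ++ xs)
prepend {c = c} ys xs (ends , valid , distinct) valid′ distinct′ separated
  rewrite walkEnd-++ c ys xs | walkEdges-++ c ys xs =
  ends , All.++⁺ valid′ valid , AllPairs.++⁺ distinct′ distinct separated

module Construction {N : ℕ} (M : List (Pair N)) (matching : AllPairs NonAdjacent M)
  (S : List (Fin N)) (w : Fin N) (w∈S : w ∈ S)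
  (n : ℕ) (room : length S + (n + 2) < N) where

  record Detour (c a : Fin N) (U : List (Fin N)) : Set where
    constructor detour
    field
      via : Fin N
      via∉S : via ∉ S
      via∉U : via ∉ U
      leg₁ : IsEdgeMinus M (c , via)
      leg₂ : IsEdgeMinus M (via , a)

  find-detour : ∀ {c a U} → c ∈ S → a ∈ S → length U ≤ n → Detour c a U
  find-detour {c} {a} {U} c∈S a∈S |U|≤n =
    detour z (z∉ ∘ S⊆F) (z∉ ∘ U⊆F) (edge-off-M M c≢z (z∉ ∘ c⊆F)) (IsEdgeMinus-swap (edge-off-M M a≢z (z∉ ∘ a⊆F)))
    where
    forbidden : List (Fin N)
    forbidden = S ++ U ++ partners c M ++ partners a M
    few : length forbidden < N
    few = ≤-trans (s≤s (begin
      length forbidden                                                  ≡⟨ length-++ S ⟩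
      length S + length (U ++ partners c M ++ partners a M)             ≡⟨ cong (length S +_) (length-++ U) ⟩
      length S + (length U + length (partners c M ++ partners a M))     ≡⟨ cong (λ k → length S + (length U + k)) (length-++ (partners c M)) ⟩
      length S + (length U + (length (partners c M) + length (partners a M)))
        ≤⟨ +-monoʳ-≤ (length S) (+-mono-≤ |U|≤n (+-mono-≤ (partners-length c M matching) (partners-length a M matching))) ⟩
      length S + (n + 2)                                                ∎)) room
      where open Data.Nat.Properties.≤-Reasoning
    z : Fin N
    z = proj₁ (missing-vertex forbidden few)
    z∉ : z ∉ forbidden
    z∉ = proj₂ (missing-vertex forbidden few)
    S⊆F : z ∈ S → z ∈ forbidden
    S⊆F = ∈-++⁺ˡ
    U⊆F : z ∈ U → z ∈ forbidden
    U⊆F p = ∈-++⁺ʳ S (∈-++⁺ˡ p)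
    c⊆F : z ∈ partners c M → z ∈ forbidden
    c⊆F p = ∈-++⁺ʳ S (∈-++⁺ʳ U (∈-++⁺ˡ p))
    a⊆F : z ∈ partners a M → z ∈ forbidden
    a⊆F p = ∈-++⁺ʳ S (∈-++⁺ʳ U (∈-++⁺ʳ (partners c M) p))
    c≢z : c ≢ z
    c≢z c≡z = z∉ (S⊆F (subst (_∈ S) c≡z c∈S))
    a≢z : a ≢ z
    a≢z a≡z = z∉ (S⊆F (subst (_∈ S) a≡z a∈S))

  Taken : List (Fin N) → Fin N → Set
  Taken U x = x ∈ S ⊎ x ∈ U

  Shape : List (Fin N) → List (Pair N) → Pair N → Set
  Shape U ds f = Any (SameEdge f) ds ⊎ ¬ Within (Taken U) f

  separated : ∀ {U ds e f} → Within (Taken U) e → All (Distinct e) ds → Shape U ds f → Distinct e f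
  separated _ e∉ds (inj₁ f∈ds) same = All¬⇒¬Any e∉ds (Any.map (SameEdge-trans same) f∈ds)
  separated e-taken _ (inj₂ f-free) = apart e-taken f-free

  avoids-prescribed : ∀ {e ds} → ¬ Within (_∈ S) e → All (Within (_∈ S)) ds → All (Distinct e) ds
  avoids-prescribed e-out = All.map (λ d-in same → e-out (Within-resp (SameEdge-sym same) d-in))

  Shape-weaken : ∀ {U U′ d ds f} → (∀ {x} → Taken U x → Taken U′ x) → Shape U′ ds f → Shape U (d ∷ ds) f
  Shape-weaken _ (inj₁ f∈ds) = inj₁ (there f∈ds)
  Shape-weaken U⊆U′ (inj₂ f-free) = inj₂ (λ (x , y) → f-free (U⊆U′ x , U⊆U′ y))

  legs-free : ∀ {c a U ds} (D : Detour c a U) → All (Shape U ds) ((c , Detour.via D) ∷ (Detour.via D , a) ∷ [])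
  legs-free {U = U} (detour z z∉S z∉U _ _) = inj₂ (λ (_ , z-taken) → z-free z-taken) ∷ inj₂ (λ (z-taken , _) → z-free z-taken) ∷ []
    where
    z-free : ¬ Taken U z
    z-free = [ z∉S , z∉U ]

  Cover : Fin N → List (Fin N) → List (Pair N) → Set
  Cover c U ds = ∃[ xs ] (IsTrail M c w xs × All (TrailContains c xs) ds × All (Shape U ds) (walkEdges c xs))

  arrive : ∀ {c U} → c ∈ S → length U ≤ n → Cover c U []
  arrive {c} c∈S |U|≤n with c ≟ w
  ... | yes refl = [] , (refl , [] , []) , [] , []
  ... | no c≢w with find-detour c∈S w∈S |U|≤n
  ...   | D@(detour z _ _ c-z z-w) =
    z ∷ w ∷ [] ,
    (refl , c-z ∷ z-w ∷ [] , (detour-distinct (proj₁ c-z) c≢w ∷ []) ∷ [] ∷ []) ,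
    [] ,
    legs-free D

  extend-direct : ∀ {a b U ds} → Within (_∈ S) (a , b) → IsEdgeMinus M (a , b) → All (Distinct (a , b)) ds →
    Cover b U ds → Cover a U ((a , b) ∷ ds)
  extend-direct {b = b} (a∈S , b∈S) a-b ab∉ds (xs , trail , covers , shape) =
    b ∷ xs ,
    prepend (_ ∷ []) xs trail (a-b ∷ []) ([] ∷ []) (All.map (separated (inj₁ a∈S , inj₁ b∈S) ab∉ds) shape ∷ []) ,
    here SameEdge-refl ∷ All.map there covers ,
    inj₁ (here SameEdge-refl) ∷ All.map (Shape-weaken (λ x → x)) shape

  extend-detour : ∀ {c a b U ds} → c ∈ S → c ≢ a → Within (_∈ S) (a , b) → IsEdgeMinus M (a , b) →
    All (Distinct (a , b)) ds → All (Within (_∈ S)) ds →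
    (D : Detour c a U) → Cover b (Detour.via D ∷ U) ds → Cover c U ((a , b) ∷ ds)
  extend-detour {c} {a} {b} c∈S c≢a (a∈S , b∈S) a-b ab∉ds ds⊆S D@(detour z z∉S _ c-z z-a) (xs , trail , covers , shape) =
    z ∷ a ∷ b ∷ xs ,
    prepend (z ∷ a ∷ b ∷ []) xs trail (c-z ∷ z-a ∷ a-b ∷ [])
      ((detour-distinct (proj₁ c-z) c≢a ∷ leaves-S₁ ∷ []) ∷ (leaves-S₂ ∷ []) ∷ [] ∷ [])
      (All.map (separated (inj₁ c∈S , inj₂ (here refl)) (avoids-prescribed cz-out ds⊆S)) shape ∷
       All.map (separated (inj₂ (here refl) , inj₁ a∈S) (avoids-prescribed za-out ds⊆S)) shape ∷
       All.map (separated (inj₁ a∈S , inj₁ b∈S) ab∉ds) shape ∷ []) ,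
    there (there (here SameEdge-refl)) ∷ All.map (λ p → there (there (there p))) covers ,
    All.++⁺ (legs-free D) (inj₁ (here SameEdge-refl) ∷ All.map (Shape-weaken (Sum.map₂ there)) shape)
    where
    cz-out : ¬ Within (_∈ S) (c , z)
    cz-out (_ , z∈S) = z∉S z∈S
    za-out : ¬ Within (_∈ S) (z , a)
    za-out (z∈S , _) = z∉S z∈S
    leaves-S₁ : Distinct (c , z) (a , b)
    leaves-S₁ same = apart (a∈S , b∈S) cz-out (SameEdge-sym same)
    leaves-S₂ : Distinct (z , a) (a , b)
    leaves-S₂ same = apart (a∈S , b∈S) za-out (SameEdge-sym same)

  cover : ∀ c U ds → c ∈ S → All (Within (_∈ S)) ds → All (IsEdgeMinus M) ds → AllPairs Distinct ds →
    length U + length ds ≤ n → Cover c U ds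
  cover c U [] c∈S _ _ _ budget = arrive c∈S (≤-trans (≤-reflexive (sym (+-identityʳ (length U)))) budget)
  cover c U ((a , b) ∷ ds) c∈S (ab⊆S ∷ ds⊆S) (a-b ∷ valid) (ab∉ds ∷ distinct) budget with c ≟ a
  ... | yes refl = extend-direct ab⊆S a-b ab∉ds
        (cover b U ds (proj₂ ab⊆S) ds⊆S valid distinct (≤-trans (m≤n+m _ 1) (≤-trans (≤-reflexive (sym (+-suc _ _))) budget)))
  ... | no c≢a = extend-detour c∈S c≢a ab⊆S a-b ab∉ds ds⊆S D
        (cover b (Detour.via D ∷ U) ds (proj₂ ab⊆S) ds⊆S valid distinct (≤-trans (≤-reflexive (sym (+-suc _ _))) budget))
    where
    D : Detour c a U
    D = find-detour c∈S (proj₁ ab⊆S) (≤-trans (m≤m+n _ _) budget)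

endpoints : ∀ {N} → List (Pair N) → List (Fin N)
endpoints es = map proj₁ es ++ map proj₂ es

endpoints-length : ∀ {N} (es : List (Pair N)) → length (endpoints es) ≡ length es + length es
endpoints-length es = trans (length-++ (map proj₁ es)) (cong₂ _+_ (length-map proj₁ es) (length-map proj₂ es))

endpoints-within : ∀ {N} (es : List (Pair N)) → All (Within (_∈ endpoints es)) es
endpoints-within es = All.tabulate (λ e∈es → ∈-++⁺ˡ (∈-map⁺ proj₁ e∈es) , ∈-++⁺ʳ (map proj₁ es) (∈-map⁺ proj₂ e∈es))

TrailContains-resp : ∀ {N} {v : Fin N} {xs : List (Fin N)} {e f : Pair N} →
  SameEdge e f → TrailContains v xs e → TrailContains v xs f
TrailContains-resp same = Any.map (SameEdge-trans (SameEdge-sym same))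

-- With n ≥ 1 and N ≥ 4n + 4 there is room for |S| ≤ 2n + 2 special
-- vertices, n detour vertices and two matching partners.
enough-room : ∀ n N → 1 ≤ n → 4 * n + 4 ≤ N → 2 + (n + n) + (n + 2) < N
enough-room (suc m) N _ 4n+4≤N = ≤-trans (subst (suc (2 + (suc m + suc m) + (suc m + 2)) ≤_) (sym (count m)) (m≤n+m _ m)) 4n+4≤N
  where
  count : ∀ m → 4 * suc m + 4 ≡ m + suc (2 + (suc m + suc m) + (suc m + 2))
  count = solve-∀

lemma4p4 : (n N : ℕ) → 2 ≤ n → 4 * n + 4 ≤ N →
    (M : List (Pair N)) → IsMatching M →
    (es : List (Pair N)) → length es ≤ n → All (IsEdgeMinus M) es →
    (v w : Fin N) →
    ∃[ xs ] (IsTrail M v w xs × All (TrailContains v xs) es)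
lemma4p4 n N 2≤n 4n+4≤N M (_ , matching) es |es|≤n valid v w =
  let (xs , trail , covers , _) = cover v [] ds (here refl) ds⊆S (All.deduplicate⁺ sameEdge? valid)
                                    (deduplicate-! (edgeSetoid N) es) (≤-trans (length-deduplicate sameEdge? es) |es|≤n)
  in xs , trail , All.deduplicate⁻ sameEdge? TrailContains-resp es covers
  where
  S : List (Fin N)
  S = v ∷ w ∷ endpoints es
  |S|≤ : length S ≤ 2 + (n + n)
  |S|≤ = s≤s (s≤s (≤-trans (≤-reflexive (endpoints-length es)) (+-mono-≤ |es|≤n |es|≤n)))
  open Construction M matching S w (there (here refl)) n
         (≤-trans (s≤s (+-monoˡ-≤ (n + 2) |S|≤)) (enough-room n N (≤-trans (s≤s z≤n) 2≤n) 4n+4≤N))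
  ds : List (Pair N)
  ds = deduplicate sameEdge? es
  ds⊆S : All (Within (_∈ S)) ds
  ds⊆S = All.deduplicate⁺ sameEdge? (All.map (λ (x , y) → there (there x) , there (there y)) (endpoints-within es))
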